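{- Let $A$ be a finite set of atoms, let $A'=\{a'\mid a\in A\}$ be a disjoint copy of $A$, and consider theories over the alphabet $A\cup A'$. Let $[A\leftarrow A']=\{a\leftarrow a'\mid a\in A\}$ and $[A'\leftarrow A]=\{a'\leftarrow a\mid a\in A\}$. For any propositional Horn theories $P$ and $R$ over $A$, $$P\cup R=cl_{head(R)}(P\circ[A\leftarrow A'])\circ cl_{body(P\circ[A\leftarrow A'])}(R)\circ cl_A([A'\leftarrow A]).$$
   Context: A theory over an alphabet is a finite set of rules $a_0\leftarrow a_1,\ldots,a_k$ ($k\ge0$), with $head(r)=\{a_0\}$, $body(r)=\{a_1,\ldots,a_k\}$, size $k$; for a set $S$ of rules $head(S),body(S)$ are the unions of heads and bodies. Write $S\subseteq_r R$ if $S\subseteq R$ has as many elements as the size of $r$. Composition: $P\circ R=\{head(r)\leftarrow body(S)\mid r\in P,\ S\subseteq_r R,\ head(S)=body(r)\}$. For a set of atoms $B$, $1_B=\{a\leftarrow a\mid a\in B\}$ and the closure is $cl_B(P)=1_B\cup P$. (Note $P\circ[A\leftarrow A']=\{head(r)\leftarrow body(r)'\mid r\in P\}$, where $body(r)'$ replaces each body atom by its copy.) -}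

module Defs where

open import Data.Nat using (ℕ; _+_)
open import Data.Fin using (Fin)
open import Data.Sum using (_⊎_; inj₁; inj₂)
open import Data.Product using (Σ; ∃; _×_; _,_)
open import Data.List using (List; []; _∷_; map; length; foldr)
open import Data.List.Relation.Unary.All using (All)
open import Data.List.Relation.Unary.Unique.Propositional using (Unique)
import Data.List.Membership.Propositional as LMem
open import Data.Fin.Subset as Sub using (Subset; ⁅_⁆; _∪_; ∣_∣)
open import Relation.Binary.PropositionalEquality using (_≡_)
open import Function.Bundles using (_⇔_)

-- The alphabet A ∪ A' where A = Fin n : inj₁ a is the atom a, inj₂ a is its copy a'.
Atom : ℕ → Set
Atom n = Fin n ⊎ Fin n

-- A rule  head ← body ; the body is a finite set of atoms of A ∪ A',
-- stored as its A-part and its A'-part (so equal rules are propositionally equal).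
record Rule (n : ℕ) : Set where
  constructor _←_,_
  field
    head   : Atom n
    bodyA  : Subset n
    bodyA' : Subset n
open Rule public

_∈body_ : ∀ {n} → Atom n → Rule n → Set
inj₁ i ∈body r = i Sub.∈ bodyA r
inj₂ i ∈body r = i Sub.∈ bodyA' r

size : ∀ {n} → Rule n → ℕ
size r = ∣ bodyA r ∣ + ∣ bodyA' r ∣

_⇐_ : ∀ {n} → Atom n → Atom n → Rule n
a ⇐ inj₁ b = a ← ⁅ b ⁆ , Sub.⊥
a ⇐ inj₂ b = a ← Sub.⊥ , ⁅ b ⁆

-- Theories (sets of rules) and sets of atoms, as predicates.
-- (Rule n is a finite type, so every such set is finite.)
Theory : ℕ → Set₁
Theory n = Rule n → Set

Atoms : ℕ → Set₁
Atoms n = Atom n → Set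

_≐_ : ∀ {n} → Theory n → Theory n → Set
P ≐ Q = ∀ r → P r ⇔ Q r

_∪ᵀ_ : ∀ {n} → Theory n → Theory n → Theory n
(P ∪ᵀ Q) r = P r ⊎ Q r

headᵀ : ∀ {n} → Theory n → Atoms n
headᵀ P a = Σ (Rule _) λ r → P r × head r ≡ a

bodyᵀ : ∀ {n} → Theory n → Atoms n
bodyᵀ P a = Σ (Rule _) λ r → P r × a ∈body r

bodyAˢ bodyA'ˢ : ∀ {n} → List (Rule n) → Subset n
bodyAˢ  S = foldr (λ r B → bodyA r ∪ B) Sub.⊥ S
bodyA'ˢ S = foldr (λ r B → bodyA' r ∪ B) Sub.⊥ S

_⊆[_]_ : ∀ {n} → List (Rule n) → Rule n → Theory n → Set
S ⊆[ r ] R = Unique S × All R S × length S ≡ size r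

-- sequential composition
-- P ∘ R = { head(r) ← body(S) | r ∈ P, S ⊆_r R, head(S) = body(r) }
_∘ᵀ_ : ∀ {n} → Theory n → Theory n → Theory n
(P ∘ᵀ R) t =
  Σ (Rule _) λ r → P r ×
  Σ (List (Rule _)) λ S → S ⊆[ r ] R ×
    (∀ a → (a LMem.∈ map head S) ⇔ (a ∈body r)) ×
    t ≡ (head r ← bodyAˢ S , bodyA'ˢ S)

infixl 20 _∘ᵀ_

𝟙 : ∀ {n} → Atoms n → Theory n
𝟙 B r = Σ (Atom _) λ a → B a × r ≡ (a ⇐ a)

cl : ∀ {n} → Atoms n → Theory n → Theory n
cl B P = 𝟙 B ∪ᵀ P

Aset : ∀ {n} → Atoms n
Aset a = ∃ λ i → a ≡ inj₁ i

[A←A'] : ∀ {n} → Theory n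
[A←A'] r = ∃ λ i → r ≡ (inj₁ i ⇐ inj₂ i)

[A'←A] : ∀ {n} → Theory n
[A'←A] r = ∃ λ i → r ≡ (inj₂ i ⇐ inj₁ i)

OverA : ∀ {n} → Theory n → Set
OverA P = ∀ r → P r → Aset (head r) × (∀ a → a ∈body r → Aset a)

-- A unit rule a ← b acts on bodies as a renaming: composing with a theory that
-- has exactly the unit rule a ← φ a for every body atom a replaces each body by
-- its image under φ.  So [A←A'] primes the bodies of P and cl_A([A'←A]) unprimes
-- every body again.  In the middle composition the identity rules of the two
-- closures merely pass the rules of R and of the primed P through; the two
-- streams cannot interfere because heads of R are unprimed while bodies of
-- P ∘ [A←A'] are primed.

module Submission where

open import Defs
open import Level using (0ℓ) renaming (suc to lsuc)
open import Data.Nat using (ℕ; _+_)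
open import Data.Bool using (true; false)
open import Data.Empty using (⊥; ⊥-elim)
open import Data.Fin using (Fin; zero; suc)
open import Data.Fin.Properties using (suc-injective)
open import Data.Fin.Subset as Sub using (Subset; _∪_; ∣_∣) renaming (_∈_ to _∈ˢ_)
open import Data.Fin.Subset.Properties using (⊆-antisym; x∈p∪q⁻; x∈p∪q⁺; ∉⊥; ∣⊥∣≡0; ∣⁅x⁆∣≡1; x∈⁅x⁆; x∈⁅y⁆⇒x≡y)
open import Data.Vec.Base using (_∷_; []; here; there)
open import Data.Sum using (inj₁; inj₂; reduce; swap)
open import Data.Sum.Properties using (inj₁-injective; inj₂-injective)
open import Data.Sum.Function.Propositional using (_⊎-cong_)
open import Data.Product using (∃; _×_; _,_; proj₁; proj₂)
open import Data.List using (List; []; _∷_; _++_; map; length; foldr)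
open import Data.List.Properties using (length-map; length-++)
open import Data.List.Relation.Unary.All as All using (All; []; _∷_)
import Data.List.Relation.Unary.All.Properties as All
open import Data.List.Relation.Unary.Any using (here; there)
open import Data.List.Relation.Unary.Unique.Propositional using (Unique)
import Data.List.Relation.Unary.Unique.Propositional.Properties as Unique
open import Data.List.Relation.Unary.AllPairs using ([]; _∷_)
open import Data.List.Membership.Propositional using () renaming (_∈_ to _∈ₗ_)
open import Data.List.Membership.Propositional.Properties using (∈-map⁺; ∈-map⁻; ∈-++⁺ˡ; ∈-++⁺ʳ; ∈-++⁻)
open import Relation.Binary.Bundles using (Setoid)
import Relation.Binary.Reasoning.Setoid as SetoidReasoning
open import Relation.Binary.PropositionalEquality using (_≡_; refl; sym; trans; cong; cong₂; subst)
open import Function using (id; _∘_)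
open import Function.Bundles using (_⇔_; mk⇔; Equivalence)
open import Function.Properties.Equivalence using (⇔-isEquivalence)
open import Relation.Binary.Structures using (IsEquivalence)

open Equivalence using (to; from)
module ⇔ = IsEquivalence (⇔-isEquivalence {ℓ = 0ℓ})

≐-setoid : ℕ → Setoid (lsuc 0ℓ) 0ℓ
≐-setoid n = record
  { Carrier       = Theory n
  ; _≈_           = _≐_
  ; isEquivalence = record
    { refl  = λ r → ⇔.refl
    ; sym   = λ e r → ⇔.sym (e r)
    ; trans = λ e f r → ⇔.trans (e r) (f r)
    }
  }

∪ᵀ-cong : ∀ {n} {P P' Q Q' : Theory n} → P ≐ P' → Q ≐ Q' → (P ∪ᵀ Q) ≐ (P' ∪ᵀ Q')
∪ᵀ-cong e f r = e r ⊎-cong f r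

∪ᵀ-comm : ∀ {n} (P Q : Theory n) → (P ∪ᵀ Q) ≐ (Q ∪ᵀ P)
∪ᵀ-comm P Q r = mk⇔ swap swap

elements : ∀ {n} → Subset n → List (Fin n)
elements []          = []
elements (true  ∷ p) = zero ∷ map suc (elements p)
elements (false ∷ p) = map suc (elements p)

length-elements : ∀ {n} (p : Subset n) → length (elements p) ≡ ∣ p ∣
length-elements []          = refl
length-elements (true  ∷ p) = cong (1 +_) (trans (length-map suc (elements p)) (length-elements p))
length-elements (false ∷ p) = trans (length-map suc (elements p)) (length-elements p)

∈-elements : ∀ {n} (p : Subset n) i → i ∈ₗ elements p ⇔ i ∈ˢ p
∈-elements p i = mk⇔ (sound p) (complete p)
  where
  sound : ∀ {n} (p : Subset n) {i} → i ∈ₗ elements p → i ∈ˢ p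
  sound (true  ∷ p) (here refl) = here
  sound (true  ∷ p) (there m) with ∈-map⁻ suc m
  ... | j , m' , refl = there (sound p m')
  sound (false ∷ p) m with ∈-map⁻ suc m
  ... | j , m' , refl = there (sound p m')
  complete : ∀ {n} (p : Subset n) {i} → i ∈ˢ p → i ∈ₗ elements p
  complete (true  ∷ p) here      = here refl
  complete (true  ∷ p) (there m) = there (∈-map⁺ suc (complete p m))
  complete (false ∷ p) (there m) = ∈-map⁺ suc (complete p m)

elements-unique : ∀ {n} (p : Subset n) → Unique (elements p)
elements-unique []          = []
elements-unique (true  ∷ p) =
  All.map⁺ (All.universal (λ _ ()) (elements p)) ∷ Unique.map⁺ suc-injective (elements-unique p)
elements-unique (false ∷ p) = Unique.map⁺ suc-injective (elements-unique p)

subset-ext : ∀ {n} {p q : Subset n} → (∀ i → i ∈ˢ p ⇔ i ∈ˢ q) → p ≡ q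
subset-ext e = ⊆-antisym (λ {i} → to (e i)) (λ {i} → from (e i))

rule-ext : ∀ {n} {r s : Rule n} → head r ≡ head s → (∀ a → a ∈body r ⇔ a ∈body s) → r ≡ s
rule-ext {r = h ← p , p'} {s = .h ← q , q'} refl e
  with subset-ext (λ i → e (inj₁ i)) | subset-ext (λ i → e (inj₂ i))
... | refl | refl = refl

∈-foldr-∪ : ∀ {n} (g : Rule n → Subset n) (S : List (Rule n)) i →
  i ∈ˢ foldr (λ r B → g r ∪ B) Sub.⊥ S ⇔ ∃ λ s → s ∈ₗ S × i ∈ˢ g s
∈-foldr-∪ g S i = mk⇔ (split S) (join S)
  where
  split : ∀ S → i ∈ˢ foldr (λ r B → g r ∪ B) Sub.⊥ S → ∃ λ s → s ∈ₗ S × i ∈ˢ g s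
  split []      m = ⊥-elim (∉⊥ m)
  split (s ∷ S) m with x∈p∪q⁻ (g s) _ m
  ... | inj₁ m' = s , here refl , m'
  ... | inj₂ m' with split S m'
  ... | s' , s'∈S , m'' = s' , there s'∈S , m''
  join : ∀ S → (∃ λ s → s ∈ₗ S × i ∈ˢ g s) → i ∈ˢ foldr (λ r B → g r ∪ B) Sub.⊥ S
  join (s ∷ S) (.s , here refl , m) = x∈p∪q⁺ (inj₁ m)
  join (s ∷ S) (s' , there s'∈S , m) = x∈p∪q⁺ (inj₂ (join S (s' , s'∈S , m)))

_←ˢ_ : ∀ {n} → Atom n → List (Rule n) → Rule n
h ←ˢ S = h ← bodyAˢ S , bodyA'ˢ S

∈body-←ˢ : ∀ {n} (h : Atom n) S a → a ∈body (h ←ˢ S) ⇔ ∃ λ s → s ∈ₗ S × a ∈body s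
∈body-←ˢ h S (inj₁ i) = ∈-foldr-∪ bodyA S i
∈body-←ˢ h S (inj₂ i) = ∈-foldr-∪ bodyA' S i

←ˢ-singleton : ∀ {n} {h : Atom n} {s} → h ≡ head s → h ←ˢ (s ∷ []) ≡ s
←ˢ-singleton {h = h} {s} e = rule-ext e λ a → ⇔.trans (∈body-←ˢ h (s ∷ []) a)
  (mk⇔ (λ { (.s , here refl , m) → m ; (_ , there () , _) }) (λ m → s , here refl , m))

head-⇐ : ∀ {n} (a b : Atom n) → head (a ⇐ b) ≡ a
head-⇐ a (inj₁ _) = refl
head-⇐ a (inj₂ _) = refl

∈body-⇐ : ∀ {n} (a b c : Atom n) → c ∈body (a ⇐ b) ⇔ c ≡ b
∈body-⇐ a (inj₁ j) (inj₁ i) = mk⇔ (λ m → cong inj₁ (x∈⁅y⁆⇒x≡y j m)) (λ { refl → x∈⁅x⁆ j })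
∈body-⇐ a (inj₁ j) (inj₂ i) = mk⇔ (λ m → ⊥-elim (∉⊥ m)) (λ ())
∈body-⇐ a (inj₂ j) (inj₁ i) = mk⇔ (λ m → ⊥-elim (∉⊥ m)) (λ ())
∈body-⇐ a (inj₂ j) (inj₂ i) = mk⇔ (λ m → cong inj₂ (x∈⁅y⁆⇒x≡y j m)) (λ { refl → x∈⁅x⁆ j })

size-⇐ : ∀ {n} (a b : Atom n) → size (a ⇐ b) ≡ 1
size-⇐ {n} a (inj₁ j) = cong₂ _+_ (∣⁅x⁆∣≡1 j) (∣⊥∣≡0 n)
size-⇐ {n} a (inj₂ j) = cong₂ _+_ (∣⊥∣≡0 n) (∣⁅x⁆∣≡1 j)

IsUnit : ∀ {n} → (Atom n → Atom n) → Rule n → Set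
IsUnit φ s = s ≡ head s ⇐ φ (head s)

units : ∀ {n} → (Atom n → Atom n) → List (Atom n) → List (Rule n)
units φ = map (λ a → a ⇐ φ a)

units-isUnit : ∀ {n} (φ : Atom n → Atom n) as → All (IsUnit φ) (units φ as)
units-isUnit φ []       = []
units-isUnit φ (a ∷ as) = cong (λ h → h ⇐ φ h) (sym (head-⇐ a (φ a))) ∷ units-isUnit φ as

map-head-units : ∀ {n} (φ : Atom n → Atom n) as → map head (units φ as) ≡ as
map-head-units φ []       = refl
map-head-units φ (a ∷ as) = cong₂ _∷_ (head-⇐ a (φ a)) (map-head-units φ as)

units-unique : ∀ {n} (φ : Atom n → Atom n) {as} → Unique as → Unique (units φ as)
units-unique φ = Unique.map⁺ λ {a} {b} e →
  trans (sym (head-⇐ a (φ a))) (trans (cong head e) (head-⇐ b (φ b)))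

∈body-←ˢ-units : ∀ {n} {φ : Atom n → Atom n} {r} h S → All (IsUnit φ) S →
  (∀ c → c ∈ₗ map head S ⇔ c ∈body r) → ∀ a → a ∈body (h ←ˢ S) ⇔ ∃ λ c → c ∈body r × φ c ≡ a
∈body-←ˢ-units {φ = φ} {r} h S unit heads a = mk⇔ image preimage
  where
  image : a ∈body (h ←ˢ S) → ∃ λ c → c ∈body r × φ c ≡ a
  image m with to (∈body-←ˢ h S a) m
  ... | s , s∈S , a∈s = head s , to (heads (head s)) (∈-map⁺ head s∈S)
                      , sym (to (∈body-⇐ (head s) _ a) (subst (a ∈body_) (All.lookup unit s∈S) a∈s))
  preimage : (∃ λ c → c ∈body r × φ c ≡ a) → a ∈body (h ←ˢ S)
  preimage (c , c∈r , refl) with ∈-map⁻ head (from (heads c) c∈r)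
  ... | s , s∈S , refl = from (∈body-←ˢ h S _)
    (s , s∈S , subst (φ (head s) ∈body_) (sym (All.lookup unit s∈S)) (from (∈body-⇐ (head s) _ _) refl))

bodyAtoms : ∀ {n} → Rule n → List (Atom n)
bodyAtoms r = map inj₁ (elements (bodyA r)) ++ map inj₂ (elements (bodyA' r))

∈-bodyAtoms : ∀ {n} (r : Rule n) a → a ∈ₗ bodyAtoms r ⇔ a ∈body r
∈-bodyAtoms r a = mk⇔ sound (complete a)
  where
  sound : a ∈ₗ bodyAtoms r → a ∈body r
  sound m with ∈-++⁻ (map inj₁ (elements (bodyA r))) m
  ... | inj₁ m' with ∈-map⁻ inj₁ m'
  ... | i , i∈ , refl = to (∈-elements (bodyA r) i) i∈
  sound m | inj₂ m' with ∈-map⁻ inj₂ m'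
  ... | i , i∈ , refl = to (∈-elements (bodyA' r) i) i∈
  complete : ∀ a → a ∈body r → a ∈ₗ bodyAtoms r
  complete (inj₁ i) m = ∈-++⁺ˡ (∈-map⁺ inj₁ (from (∈-elements (bodyA r) i) m))
  complete (inj₂ i) m = ∈-++⁺ʳ _ (∈-map⁺ inj₂ (from (∈-elements (bodyA' r) i) m))

bodyAtoms-unique : ∀ {n} (r : Rule n) → Unique (bodyAtoms r)
bodyAtoms-unique r = Unique.++⁺
  (Unique.map⁺ inj₁-injective (elements-unique (bodyA r)))
  (Unique.map⁺ inj₂-injective (elements-unique (bodyA' r)))
  disjoint
  where
  disjoint : ∀ {a} → a ∈ₗ map inj₁ (elements (bodyA r)) × a ∈ₗ map inj₂ (elements (bodyA' r)) → ⊥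
  disjoint (m , m') with ∈-map⁻ inj₁ m | ∈-map⁻ inj₂ m'
  ... | _ , _ , refl | _ , _ , ()

length-bodyAtoms : ∀ {n} (r : Rule n) → length (bodyAtoms r) ≡ size r
length-bodyAtoms r = trans (length-++ (map inj₁ (elements (bodyA r))))
  (cong₂ _+_ (trans (length-map inj₁ (elements (bodyA r))) (length-elements (bodyA r)))
             (trans (length-map inj₂ (elements (bodyA' r))) (length-elements (bodyA' r))))

rename : ∀ {n} → (Atom n → Atom n) → Rule n → Rule n
rename φ r = head r ←ˢ units φ (bodyAtoms r)

heads-units-bodyAtoms : ∀ {n} (φ : Atom n → Atom n) r c → c ∈ₗ map head (units φ (bodyAtoms r)) ⇔ c ∈body r
heads-units-bodyAtoms φ r c rewrite map-head-units φ (bodyAtoms r) = ∈-bodyAtoms r c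

∈body-rename : ∀ {n} (φ : Atom n → Atom n) r a → a ∈body rename φ r ⇔ ∃ λ c → c ∈body r × φ c ≡ a
∈body-rename φ r = ∈body-←ˢ-units (head r) _ (units-isUnit φ (bodyAtoms r)) (heads-units-bodyAtoms φ r)

rename-fixed : ∀ {n} {φ : Atom n → Atom n} {r} → (∀ a → a ∈body r → φ a ≡ a) → rename φ r ≡ r
rename-fixed {φ = φ} {r} fixed = rule-ext refl λ a → ⇔.trans (∈body-rename φ r a)
  (mk⇔ (λ { (c , c∈r , refl) → subst (_∈body r) (sym (fixed c c∈r)) c∈r }) (λ m → a , m , fixed a m))

rename-∘ : ∀ {n} (ψ φ : Atom n → Atom n) r → rename ψ (rename φ r) ≡ rename (ψ ∘ φ) r
rename-∘ ψ φ r = rule-ext refl λ a → ⇔.trans (∈body-rename ψ (rename φ r) a) (⇔.trans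
  (mk⇔ (λ { (b , b∈ , refl) → push-ψ (to (∈body-rename φ r b) b∈) })
       (λ { (c , c∈r , refl) → φ c , from (∈body-rename φ r (φ c)) (c , c∈r , refl) , refl }))
  (⇔.sym (∈body-rename (ψ ∘ φ) r a)))
  where
  push-ψ : ∀ {b} → (∃ λ c → c ∈body r × φ c ≡ b) → ∃ λ c → c ∈body r × ψ (φ c) ≡ ψ b
  push-ψ (c , c∈r , refl) = c , c∈r , refl

renameᵀ : ∀ {n} → (Atom n → Atom n) → Theory n → Theory n
renameᵀ φ Q t = ∃ λ r → Q r × t ≡ rename φ r

renameᵀ-cong : ∀ {n} (φ : Atom n → Atom n) {Q Q'} → Q ≐ Q' → renameᵀ φ Q ≐ renameᵀ φ Q'
renameᵀ-cong φ e t = mk⇔ (λ { (r , Qr , eq) → r , to (e r) Qr , eq }) (λ { (r , Qr , eq) → r , from (e r) Qr , eq })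

renameᵀ-∘ : ∀ {n} (ψ φ : Atom n → Atom n) Q → renameᵀ ψ (renameᵀ φ Q) ≐ renameᵀ (ψ ∘ φ) Q
renameᵀ-∘ ψ φ Q t = mk⇔
  (λ { (_ , (r , Qr , refl) , refl) → r , Qr , rename-∘ ψ φ r })
  (λ { (r , Qr , refl) → rename φ r , (r , Qr , refl) , sym (rename-∘ ψ φ r) })

renameᵀ-fixed : ∀ {n} {φ : Atom n → Atom n} {Q} →
  (∀ {r} → Q r → ∀ a → a ∈body r → φ a ≡ a) → renameᵀ φ Q ≐ Q
renameᵀ-fixed {Q = Q} fixed t = mk⇔
  (λ { (r , Qr , refl) → subst Q (sym (rename-fixed (fixed Qr))) Qr })
  (λ Qt → t , Qt , sym (rename-fixed (fixed Qt)))

∘ᵀ-units : ∀ {n} (φ : Atom n → Atom n) {Q F : Theory n} → (∀ {s} → F s → IsUnit φ s) →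
  (∀ {r} → Q r → ∀ a → a ∈body r → F (a ⇐ φ a)) → (Q ∘ᵀ F) ≐ renameᵀ φ Q
∘ᵀ-units φ {Q} {F} unit defined t = mk⇔ rename-of compose
  where
  rename-of : (Q ∘ᵀ F) t → renameᵀ φ Q t
  rename-of (r , Qr , S , (_ , S⊆F , _) , heads , refl) = r , Qr , rule-ext refl λ a →
    ⇔.trans (∈body-←ˢ-units (head r) S (All.map unit S⊆F) heads a) (⇔.sym (∈body-rename φ r a))
  compose : renameᵀ φ Q t → (Q ∘ᵀ F) t
  compose (r , Qr , refl) = r , Qr , units φ (bodyAtoms r)
    , (units-unique φ (bodyAtoms-unique r)
      , All.map⁺ (All.tabulate λ {a} m → defined Qr a (to (∈-bodyAtoms r a) m))
      , trans (length-map _ (bodyAtoms r)) (length-bodyAtoms r))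
    , heads-units-bodyAtoms φ r , refl

𝟙-∘ᵀ : ∀ {n} (B : Atoms n) (Q : Theory n) → (𝟙 B ∘ᵀ Q) ≐ λ t → B (head t) × Q t
𝟙-∘ᵀ B Q t = mk⇔ select (λ (Bh , Qt) → extend Bh Qt)
  where
  length≡1 : ∀ (S : List (Rule _)) → length S ≡ 1 → ∃ λ s → S ≡ s ∷ []
  length≡1 (s ∷ []) _ = s , refl
  select : (𝟙 B ∘ᵀ Q) t → B (head t) × Q t
  select (_ , (a , Ba , refl) , S , (_ , S⊆Q , len) , heads , refl)
    with length≡1 S (trans len (size-⇐ a a))
  ... | s , refl = subst B (sym (head-⇐ a a)) Ba , subst Q (sym (←ˢ-singleton head-s)) (All.head S⊆Q)
    where
    head-s : head (a ⇐ a) ≡ head s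
    head-s = trans (head-⇐ a a) (sym (to (∈body-⇐ a a (head s)) (to (heads (head s)) (here refl))))
  extend : B (head t) → Q t → (𝟙 B ∘ᵀ Q) t
  extend Bh Qt = head t ⇐ head t , (head t , Bh , refl) , t ∷ []
    , (([] ∷ []) , (Qt ∷ []) , sym (size-⇐ (head t) (head t)))
    , (λ c → mk⇔ (λ { (here refl) → from (∈body-⇐ _ _ _) refl ; (there ()) })
                 (λ m → here (to (∈body-⇐ (head t) (head t) c) m)))
    , sym (←ˢ-singleton (head-⇐ (head t) (head t)))

∘ᵀ-congˡ : ∀ {n} {P P' : Theory n} (Q : Theory n) → P ≐ P' → (P ∘ᵀ Q) ≐ (P' ∘ᵀ Q)
∘ᵀ-congˡ Q e t = mk⇔
  (λ { (r , Pr , rest) → r , to (e r) Pr , rest })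
  (λ { (r , Pr , rest) → r , from (e r) Pr , rest })

∘ᵀ-distribʳ-∪ᵀ : ∀ {n} (P P' Q : Theory n) → ((P ∪ᵀ P') ∘ᵀ Q) ≐ ((P ∘ᵀ Q) ∪ᵀ (P' ∘ᵀ Q))
∘ᵀ-distribʳ-∪ᵀ P P' Q t = mk⇔
  (λ { (r , inj₁ Pr , rest) → inj₁ (r , Pr , rest) ; (r , inj₂ Pr , rest) → inj₂ (r , Pr , rest) })
  (λ { (inj₁ (r , Pr , rest)) → r , inj₁ Pr , rest ; (inj₂ (r , Pr , rest)) → r , inj₂ Pr , rest })

∘ᵀ-monoʳ-on : ∀ {n} {P Q Q' : Theory n} → (∀ {r s} → P r → head s ∈body r → Q s → Q' s) →
  ∀ t → (P ∘ᵀ Q) t → (P ∘ᵀ Q') t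
∘ᵀ-monoʳ-on {Q' = Q'} mono t (r , Pr , S , (u , S⊆Q , len) , heads , eq) =
  r , Pr , S , (u , All.tabulate transport , len) , heads , eq
  where
  transport : ∀ {s} → s ∈ₗ S → Q' s
  transport {s} s∈S = mono Pr (to (heads (head s)) (∈-map⁺ head s∈S)) (All.lookup S⊆Q s∈S)

∘ᵀ-congʳ-on : ∀ {n} {P Q Q' : Theory n} → (∀ {r s} → P r → head s ∈body r → Q s ⇔ Q' s) →
  (P ∘ᵀ Q) ≐ (P ∘ᵀ Q')
∘ᵀ-congʳ-on e t = mk⇔ (∘ᵀ-monoʳ-on (λ Pr m → to (e Pr m)) t) (∘ᵀ-monoʳ-on (λ Pr m → from (e Pr m)) t)

cl⇔-outside : ∀ {n} {B : Atoms n} {R : Theory n} {s} → (B (head s) → ⊥) → cl B R s ⇔ R s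
cl⇔-outside {B = B} out = mk⇔
  (λ { (inj₁ (a , Ba , refl)) → ⊥-elim (out (subst B (sym (head-⇐ a a)) Ba)) ; (inj₂ Rs) → Rs })
  inj₂

cl⇔-𝟙 : ∀ {n} {B : Atoms n} {R : Theory n} {s} → (headᵀ R (head s) → ⊥) → cl B R s ⇔ 𝟙 B s
cl⇔-𝟙 {s = s} out = mk⇔ (λ { (inj₁ u) → u ; (inj₂ Rs) → ⊥-elim (out (s , Rs , refl)) }) inj₁

𝟙-isUnit : ∀ {n} {B : Atoms n} {s} → 𝟙 B s → IsUnit id s
𝟙-isUnit (a , _ , refl) = cong (λ h → h ⇐ h) (sym (head-⇐ a a))

cl-head-∘ᵀ-cl-body : ∀ {n} (Q R : Theory n) → (∀ a → headᵀ R a → bodyᵀ Q a → ⊥) →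
  (cl (headᵀ R) Q ∘ᵀ cl (bodyᵀ Q) R) ≐ (Q ∪ᵀ R)
cl-head-∘ᵀ-cl-body {n} Q R disjoint = begin
  cl (headᵀ R) Q ∘ᵀ cl (bodyᵀ Q) R
    ≈⟨ ∘ᵀ-distribʳ-∪ᵀ (𝟙 (headᵀ R)) Q (cl (bodyᵀ Q) R) ⟩
  (𝟙 (headᵀ R) ∘ᵀ cl (bodyᵀ Q) R) ∪ᵀ (Q ∘ᵀ cl (bodyᵀ Q) R)
    ≈⟨ ∪ᵀ-cong (∘ᵀ-congʳ-on identities-see-R) (∘ᵀ-congʳ-on Q-sees-identities) ⟩
  (𝟙 (headᵀ R) ∘ᵀ R) ∪ᵀ (Q ∘ᵀ 𝟙 (bodyᵀ Q))
    ≈⟨ ∪ᵀ-cong (𝟙-∘ᵀ (headᵀ R) R) (∘ᵀ-units id 𝟙-isUnit (λ Qr a m → a , (_ , Qr , m) , refl)) ⟩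
  (λ t → headᵀ R (head t) × R t) ∪ᵀ renameᵀ id Q
    ≈⟨ ∪ᵀ-cong (λ t → mk⇔ proj₂ (λ Rt → (t , Rt , refl) , Rt)) (renameᵀ-fixed (λ _ _ _ → refl)) ⟩
  R ∪ᵀ Q
    ≈⟨ ∪ᵀ-comm R Q ⟩
  Q ∪ᵀ R ∎
  where
  open SetoidReasoning (≐-setoid n)
  identities-see-R : ∀ {r s} → 𝟙 (headᵀ R) r → head s ∈body r → cl (bodyᵀ Q) R s ⇔ R s
  identities-see-R (a , Ra , refl) m =
    cl⇔-outside {R = R} (disjoint a Ra ∘ subst (bodyᵀ Q) (to (∈body-⇐ a a _) m))
  Q-sees-identities : ∀ {r s} → Q r → head s ∈body r → cl (bodyᵀ Q) R s ⇔ 𝟙 (bodyᵀ Q) s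
  Q-sees-identities Qr m = cl⇔-𝟙 (λ Rh → disjoint _ Rh (_ , Qr , m))

prime unprime : ∀ {n} → Atom n → Atom n
prime   = inj₂ ∘ reduce
unprime = inj₁ ∘ reduce

∘ᵀ-[A←A'] : ∀ {n} {Q : Theory n} → OverA Q → (Q ∘ᵀ [A←A']) ≐ renameᵀ prime Q
∘ᵀ-[A←A'] {Q = Q} overA = ∘ᵀ-units prime (λ { (i , refl) → refl }) defined
  where
  defined : ∀ {r} → Q r → ∀ a → a ∈body r → [A←A'] (a ⇐ prime a)
  defined {r} Qr a m with proj₂ (overA r Qr) a m
  ... | i , refl = i , refl

∘ᵀ-cl-[A'←A] : ∀ {n} (Q : Theory n) → (Q ∘ᵀ cl Aset [A'←A]) ≐ renameᵀ unprime Q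
∘ᵀ-cl-[A'←A] Q = ∘ᵀ-units unprime unit defined
  where
  unit : ∀ {s} → cl Aset [A'←A] s → IsUnit unprime s
  unit (inj₁ (_ , (i , refl) , refl)) = refl
  unit (inj₂ (i , refl))              = refl
  defined : ∀ {r} → Q r → ∀ a → a ∈body r → cl Aset [A'←A] (a ⇐ unprime a)
  defined _ (inj₁ i) _ = inj₁ (inj₁ i , (i , refl) , refl)
  defined _ (inj₂ i) _ = inj₂ (i , refl)

unprime-fixes-A : ∀ {n} {Q : Theory n} → OverA Q → ∀ {r} → Q r → ∀ a → a ∈body r → unprime a ≡ a
unprime-fixes-A overA {r} Qr a m with proj₂ (overA r Qr) a m
... | i , refl = refl

heads-disjoint-primed-bodies : ∀ {n} {P R : Theory n} → OverA P → OverA R →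
  ∀ a → headᵀ R a → bodyᵀ (P ∘ᵀ [A←A']) a → ⊥
heads-disjoint-primed-bodies {P = P} oP oR a (r , Rr , refl) (r' , P'r' , m) with to (∘ᵀ-[A←A'] oP r') P'r'
... | p , _ , refl with to (∈body-rename prime p a) m | proj₁ (oR r Rr)
... | _ , _ , primed | _ , unprimed with trans primed unprimed
... | ()

∘ᵀ-unprime-OverA : ∀ {n} {Q : Theory n} → OverA Q → (Q ∘ᵀ cl Aset [A'←A]) ≐ Q
∘ᵀ-unprime-OverA {n} {Q} overA = begin
  Q ∘ᵀ cl Aset [A'←A] ≈⟨ ∘ᵀ-cl-[A'←A] Q ⟩
  renameᵀ unprime Q   ≈⟨ renameᵀ-fixed (unprime-fixes-A overA) ⟩
  Q                   ∎
  where open SetoidReasoning (≐-setoid n)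

∘ᵀ-prime-unprime : ∀ {n} {Q : Theory n} → OverA Q → (Q ∘ᵀ [A←A'] ∘ᵀ cl Aset [A'←A]) ≐ Q
∘ᵀ-prime-unprime {n} {Q} overA = begin
  Q ∘ᵀ [A←A'] ∘ᵀ cl Aset [A'←A]     ≈⟨ ∘ᵀ-cl-[A'←A] (Q ∘ᵀ [A←A']) ⟩
  renameᵀ unprime (Q ∘ᵀ [A←A'])     ≈⟨ renameᵀ-cong unprime (∘ᵀ-[A←A'] overA) ⟩
  renameᵀ unprime (renameᵀ prime Q) ≈⟨ renameᵀ-∘ unprime prime Q ⟩
  renameᵀ (unprime ∘ prime) Q       ≈⟨ renameᵀ-fixed (unprime-fixes-A overA) ⟩
  Q                                 ∎
  where open SetoidReasoning (≐-setoid n)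

theorem5p7 : (n : ℕ) (P R : Theory n) → OverA P → OverA R →
    (P ∪ᵀ R) ≐ (cl (headᵀ R) (P ∘ᵀ [A←A']) ∘ᵀ cl (bodyᵀ (P ∘ᵀ [A←A'])) R ∘ᵀ cl Aset [A'←A])
theorem5p7 n P R oP oR = begin
  P ∪ᵀ R
    ≈⟨ ∪ᵀ-cong (∘ᵀ-prime-unprime oP) (∘ᵀ-unprime-OverA oR) ⟨
  (P' ∘ᵀ Z) ∪ᵀ (R ∘ᵀ Z)
    ≈⟨ ∘ᵀ-distribʳ-∪ᵀ P' R Z ⟨
  (P' ∪ᵀ R) ∘ᵀ Z
    ≈⟨ ∘ᵀ-congˡ Z (cl-head-∘ᵀ-cl-body P' R (heads-disjoint-primed-bodies oP oR)) ⟨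
  cl (headᵀ R) P' ∘ᵀ cl (bodyᵀ P') R ∘ᵀ Z ∎
  where
  open SetoidReasoning (≐-setoid n)
  P' Z : Theory n
  P' = P ∘ᵀ [A←A']
  Z  = cl Aset [A'←A]
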